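{- Let $a>1$, $h\geq 1$, $d\geq 1$ be integers with $\gcd(a,d)=1$, and let $A=(a^2,\ ha^2+d,\ ha^2+ad,\ ha^2+(a+1)d)$. Then \begin{align*} g(A)&=ha^3+(d-h-1)a^2-d,\\ n(A)&=\frac{2}{3}ha^3+\frac{1}{2}(d-h-1)a^2-\frac{1}{6}ha+\frac{1}{2}(1-d),\\ s(A)&=\frac{1}{24}\Big(6h^2a^6+(9dh-8h^2-8h)a^5+(4d^2-5dh-6d+6h+2)a^4\\ &\qquad+(2h^2-11dh+2h)a^3+(5dh-6d^2+6d)a^2+2dha+2d^2-2\Big). \end{align*}
   Context: For a vector $A=(a_1,\dots,a_n)$ of positive integers with $\gcd(A)=1$, an integer $a_0\geq 0$ is representable by $A$ if $a_0=\sum_i a_ix_i$ for some $x_i\in\mathbb{N}=\{0,1,2,\dots\}$. Let $\mathcal{NR}(A)$ be the (finite) set of nonnegative integers not representable by $A$. The Frobenius number is $g(A)=\max\mathcal{NR}(A)$, the Sylvester number is $n(A)=\#\mathcal{NR}(A)$, and the Sylvester sum is $s(A)=\sum_{m\in\mathcal{NR}(A)}m$. -}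

module Defs where

open import Data.Nat using (ℕ; _*_; _≤_)
open import Data.Vec using (Vec; []; _∷_; zipWith; sum)
open import Data.List using (List)
open import Data.List.Membership.Propositional using (_∈_)
open import Data.List.Relation.Unary.All using (All)
open import Data.List.Relation.Unary.Unique.Propositional using (Unique)
open import Data.Product using (Σ; _×_)
open import Relation.Binary.PropositionalEquality using (_≡_)
open import Relation.Nullary using (¬_)
open import Function.Bundles using (_⇔_)

Representable : ∀ {n} → Vec ℕ n → ℕ → Set
Representable {n} A m = Σ (Vec ℕ n) λ x → sum (zipWith _*_ A x) ≡ m

IsNRList : ∀ {n} → Vec ℕ n → List ℕ → Set
IsNRList A L = Unique L × (∀ m → (m ∈ L) ⇔ (¬ Representable A m))

IsMaxOf : List ℕ → ℕ → Set
IsMaxOf L g = (g ∈ L) × All (λ m → m ≤ g) L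

vecA : ℕ → ℕ → ℕ → Vec ℕ 4
vecA a h d = a * a ∷ h * (a * a) + d ∷ h * (a * a) + a * d ∷ h * (a * a) + (a Data.Nat.+ 1) * d ∷ []
  where open Data.Nat using (_+_)

module Submission where

-- Work modulo N = a². A combination x₀ a² + x₁ (h a² + d) + x₂ (h a² + a d) + x₃ (h a² + (a + 1) d)
-- equals (x₀ + h c) a² + d S with c = x₁ + x₂ + x₃ and S = (x₁ + x₃) + (x₂ + x₃) a. As gcd(a, d) = 1,
-- every class modulo N is that of d t for a unique t < N, and writing t = i + j a with i, j < a,
-- S ≡ t forces c ≥ max(i, j). So the least representable element of the class (its Apéry element)
-- is w t = h max(i, j) a² + d t, the gaps of the class are w t - k a² for 1 ≤ k ≤ w t / a², and
-- g(A) = w (a² - 1) - a². Selmer's formulas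
--   a² n(A) = Σ w t - Σ t,    2 a² s(A) = Σ (w t)² - Σ t² - a² (Σ w t - Σ t)
-- reduce n(A) and s(A) to sums of max(i, j), max(i, j)² and max(i, j) (i + j a) over the a × a
-- grid, which are evaluated gnomon by gnomon.

open import Data.Nat as ℕ using (ℕ; zero; suc; NonZero)
open import Data.Nat.DivMod using (_%_; _/_)
open import Data.Nat.ListAction using (sum)
open import Data.Nat.Coprimality as Coprimality using (Coprime)
open import Data.List using (List; []; _++_; applyDownFrom; length)
open import Data.List.Membership.Propositional using (_∈_)
open import Data.List.Relation.Unary.All as All using (All)
open import Data.Product using (Σ; _×_; _,_; proj₁; proj₂)
open import Relation.Binary.PropositionalEquality
open import Defs

module IntegerSums where
  open import Data.Nat using (_<_; _⊔_; _^_)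
  import Data.Nat.Properties as ℕₚ
  open import Data.Integer using (ℤ; +_; 0ℤ; _+_; _-_; _*_)
  open import Data.Integer.Properties using (pos-*; +-assoc; +-comm; *-comm; *-zeroʳ; *-distribˡ-+; +-identityʳ; +-0-commutativeMonoid)
  open import Data.Integer.Tactic.RingSolver using (solve-∀; ring)
  open import Tactic.RingSolver.Core.AlmostCommutativeRing using (AlmostCommutativeRing)
  -- The ring solver only understands its own exponentiation, which is not definitionally
  -- that of Data.Nat or Data.Integer.
  open AlmostCommutativeRing ring using () renaming (_^_ to _^′_)
  open import Data.Fin as Fin using (Fin; toℕ; fromℕ<)
  import Data.Fin.Properties as Fin
  open import Data.Fin.Permutation using (Permutation; permutation; _⟨$⟩ʳ_)
  import Algebra.Properties.CommutativeMonoid.Sum +-0-commutativeMonoid as Fin∑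
  open import Function.Base using (_∘_)

  ∑ : ℕ → (ℕ → ℤ) → ℤ
  ∑ zero    f = 0ℤ
  ∑ (suc n) f = ∑ n f + f n

  infixl 10 ∑
  syntax ∑ n (λ t → e) = ∑[ t < n ] e

  ∑-cong : ∀ {f g} n → (∀ t → t < n → f t ≡ g t) → ∑ n f ≡ ∑ n g
  ∑-cong zero    eq = refl
  ∑-cong (suc n) eq = cong₂ _+_ (∑-cong n (λ t t<n → eq t (ℕₚ.m<n⇒m<1+n t<n))) (eq n ℕₚ.≤-refl)

  ∑-distrib-+ : ∀ n f g → ∑[ t < n ] (f t + g t) ≡ ∑ n f + ∑ n g
  ∑-distrib-+ zero    f g = refl
  ∑-distrib-+ (suc n) f g = trans (cong (_+ (f n + g n)) (∑-distrib-+ n f g)) (lemma (∑ n f) (∑ n g) (f n) (g n))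
    where
    lemma : ∀ x y u v → x + y + (u + v) ≡ x + u + (y + v)
    lemma = solve-∀

  ∑-distrib-- : ∀ n f g → ∑[ t < n ] (f t - g t) ≡ ∑ n f - ∑ n g
  ∑-distrib-- zero    f g = refl
  ∑-distrib-- (suc n) f g = trans (cong (_+ (f n - g n)) (∑-distrib-- n f g)) (lemma (∑ n f) (∑ n g) (f n) (g n))
    where
    lemma : ∀ x y u v → x - y + (u - v) ≡ x + u - (y + v)
    lemma = solve-∀

  ∑-*ˡ : ∀ n c f → ∑[ t < n ] (c * f t) ≡ c * ∑ n f
  ∑-*ˡ zero    c f = sym (*-zeroʳ c)
  ∑-*ˡ (suc n) c f = trans (cong (_+ c * f n) (∑-*ˡ n c f)) (sym (*-distribˡ-+ c (∑ n f) (f n)))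

  ∑-const : ∀ n c → ∑[ t < n ] c ≡ + n * c
  ∑-const zero    c = refl
  ∑-const (suc n) c = trans (cong (_+ c) (∑-const n c)) (lemma (+ n) c)
    where
    lemma : ∀ n c → n * c + c ≡ (+ 1 + n) * c
    lemma = solve-∀

  ∑-split : ∀ k m f → ∑ (k ℕ.+ m) f ≡ ∑ k f + ∑[ i < m ] f (k ℕ.+ i)
  ∑-split k zero    f = trans (cong (λ n → ∑ n f) (ℕₚ.+-identityʳ k)) (sym (+-identityʳ (∑ k f)))
  ∑-split k (suc m) f = begin
    ∑ (k ℕ.+ suc m) f                                ≡⟨ cong (λ n → ∑ n f) (ℕₚ.+-suc k m) ⟩
    ∑ (k ℕ.+ m) f + f (k ℕ.+ m)                      ≡⟨ cong (_+ f (k ℕ.+ m)) (∑-split k m f) ⟩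
    ∑ k f + ∑[ i < m ] f (k ℕ.+ i) + f (k ℕ.+ m)     ≡⟨ +-assoc (∑ k f) _ _ ⟩
    ∑ k f + ∑[ i < suc m ] f (k ℕ.+ i)               ∎
    where open ≡-Reasoning

  ∑-pairs : ∀ n m f → ∑ (n ℕ.* m) f ≡ ∑[ j < n ] ∑[ i < m ] f (j ℕ.* m ℕ.+ i)
  ∑-pairs zero    m f = refl
  ∑-pairs (suc n) m f = begin
    ∑ (m ℕ.+ n ℕ.* m) f                                     ≡⟨ cong (λ k → ∑ k f) (ℕₚ.+-comm m (n ℕ.* m)) ⟩
    ∑ (n ℕ.* m ℕ.+ m) f                                     ≡⟨ ∑-split (n ℕ.* m) m f ⟩
    ∑ (n ℕ.* m) f + ∑[ i < m ] f (n ℕ.* m ℕ.+ i)            ≡⟨ cong (_+ ∑[ i < m ] f (n ℕ.* m ℕ.+ i)) (∑-pairs n m f) ⟩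
    ∑[ j < suc n ] ∑[ i < m ] f (j ℕ.* m ℕ.+ i)             ∎
    where open ≡-Reasoning

  ∑-unshift : ∀ n f → ∑ (suc n) f ≡ f 0 + ∑[ t < n ] f (suc t)
  ∑-unshift zero    f = +-comm 0ℤ (f 0)
  ∑-unshift (suc n) f = trans (cong (_+ f (suc n)) (∑-unshift n f)) (+-assoc (f 0) _ _)

  ∑≡Fin∑ : ∀ n f → ∑ n f ≡ Fin∑.sum {n} (f ∘ toℕ)
  ∑≡Fin∑ zero    f = refl
  ∑≡Fin∑ (suc n) f = trans (∑-unshift n f) (cong (_+_ (f 0)) (∑≡Fin∑ n (f ∘ suc)))

  ∑-permute : ∀ n f σ τ → (∀ t → t < n → σ t < n) → (∀ t → t < n → τ t < n) →
              (∀ t → t < n → σ (τ t) ≡ t) → (∀ t → t < n → τ (σ t) ≡ t) →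
              ∑[ t < n ] f (σ t) ≡ ∑ n f
  ∑-permute n f σ τ σ<n τ<n στ τσ = begin
    ∑[ t < n ] f (σ t)                   ≡⟨ ∑≡Fin∑ n (f ∘ σ) ⟩
    Fin∑.sum {n} (f ∘ σ ∘ toℕ)           ≡⟨ Fin∑.sum-cong-≗ (λ i → cong f (Fin.toℕ-fromℕ< (σ<n _ (Fin.toℕ<n i)))) ⟨
    Fin∑.sum {n} (f ∘ toℕ ∘ (π ⟨$⟩ʳ_))   ≡⟨ Fin∑.sum-permute (f ∘ toℕ) π ⟨
    Fin∑.sum {n} (f ∘ toℕ)               ≡⟨ ∑≡Fin∑ n f ⟨
    ∑ n f                                ∎
    where
    open ≡-Reasoning
    lift : (g : ℕ → ℕ) → (∀ t → t < n → g t < n) → Fin n → Fin n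
    lift g g<n i = fromℕ< (g<n (toℕ i) (Fin.toℕ<n i))
    lift-inverse : ∀ g h g<n h<n → (∀ t → t < n → g (h t) ≡ t) → ∀ i → lift g g<n (lift h h<n i) ≡ i
    lift-inverse g h g<n h<n gh i = Fin.toℕ-injective (begin
      toℕ (lift g g<n (lift h h<n i))   ≡⟨ Fin.toℕ-fromℕ< _ ⟩
      g (toℕ (lift h h<n i))            ≡⟨ cong g (Fin.toℕ-fromℕ< _) ⟩
      g (h (toℕ i))                     ≡⟨ gh (toℕ i) (Fin.toℕ<n i) ⟩
      toℕ i                             ∎)
    π : Permutation n n
    π = permutation (lift σ σ<n) (lift τ τ<n) (lift-inverse σ τ σ<n τ<n στ) (lift-inverse τ σ τ<n σ<n τσ)

  ∑-telescope : ∀ (F : ℤ → ℤ) c f → F 0ℤ ≡ 0ℤ → (∀ t → c * f t ≡ F (+ suc t) - F (+ t)) →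
                ∀ n → c * ∑ n f ≡ F (+ n)
  ∑-telescope F c f F0 step zero    = trans (*-zeroʳ c) (sym F0)
  ∑-telescope F c f F0 step (suc n) = begin
    c * (∑ n f + f n)                     ≡⟨ *-distribˡ-+ c (∑ n f) (f n) ⟩
    c * ∑ n f + c * f n                   ≡⟨ cong₂ _+_ (∑-telescope F c f F0 step n) (step n) ⟩
    F (+ n) + (F (+ suc n) - F (+ n))     ≡⟨ lemma (F (+ n)) (F (+ suc n)) ⟩
    F (+ suc n)                           ∎
    where
    open ≡-Reasoning
    lemma : ∀ x y → x + (y - x) ≡ y
    lemma = solve-∀

  ∑-id : ∀ n → + 2 * ∑[ t < n ] (+ t) ≡ + n * (+ n - + 1)
  ∑-id = ∑-telescope (λ x → x * (x - + 1)) (+ 2) +_ refl (λ t → lemma (+ t))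
    where
    lemma : ∀ x → + 2 * x ≡ (+ 1 + x) * ((+ 1 + x) - + 1) - x * (x - + 1)
    lemma = solve-∀

  ∑-square : ∀ n → + 6 * ∑[ t < n ] (+ t * + t) ≡ + n * (+ n - + 1) * (+ 2 * + n - + 1)
  ∑-square = ∑-telescope (λ x → x * (x - + 1) * (+ 2 * x - + 1)) (+ 6) (λ t → + t * + t) refl (λ t → lemma (+ t))
    where
    lemma : ∀ x → + 6 * (x * x) ≡ (+ 1 + x) * ((+ 1 + x) - + 1) * (+ 2 * (+ 1 + x) - + 1) - x * (x - + 1) * (+ 2 * x - + 1)
    lemma = solve-∀

  gnomon : (ℕ → ℕ → ℕ → ℤ) → ℕ → ℤ
  gnomon g m = ∑[ i < m ] g m i m + ∑[ j < m ] g m m j + g m m m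

  ∑-square-⊔ : ∀ n (g : ℕ → ℕ → ℕ → ℤ) → ∑[ j < n ] ∑[ i < n ] g (i ⊔ j) i j ≡ ∑[ m < n ] gnomon g m
  ∑-square-⊔ zero    g = refl
  ∑-square-⊔ (suc n) g = begin
    ∑[ j < suc n ] ∑[ i < suc n ] g (i ⊔ j) i j
      ≡⟨ cong (_+ (∑[ i < n ] g (i ⊔ n) i n + g (n ⊔ n) n n)) (∑-distrib-+ n (λ j → ∑[ i < n ] g (i ⊔ j) i j) (λ j → g (n ⊔ j) n j)) ⟩
    ∑[ j < n ] ∑[ i < n ] g (i ⊔ j) i j + ∑[ j < n ] g (n ⊔ j) n j + (∑[ i < n ] g (i ⊔ n) i n + g (n ⊔ n) n n)
      ≡⟨ cong₂ _+_ (cong₂ _+_ (∑-square-⊔ n g) (∑-cong n (λ j j<n → cong (λ m → g m n j) (ℕₚ.m≥n⇒m⊔n≡m (ℕₚ.<⇒≤ j<n)))))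
                   (cong₂ _+_ (∑-cong n (λ i i<n → cong (λ m → g m i n) (ℕₚ.m≤n⇒m⊔n≡n (ℕₚ.<⇒≤ i<n))))
                              (cong (λ m → g m n n) (ℕₚ.⊔-idem n))) ⟩
    ∑[ m < n ] gnomon g m + ∑[ j < n ] g n n j + (∑[ i < n ] g n i n + g n n n)
      ≡⟨ lemma (∑[ m < n ] gnomon g m) (∑[ j < n ] g n n j) (∑[ i < n ] g n i n) (g n n n) ⟩
    ∑[ m < suc n ] gnomon g m
      ∎
    where
    open ≡-Reasoning
    lemma : ∀ s c r x → s + c + (r + x) ≡ s + (r + c + x)
    lemma = solve-∀

  ∑-affine : ∀ n u v → ∑[ i < n ] (u * + i + v) ≡ u * ∑[ i < n ] (+ i) + + n * v
  ∑-affine n u v = trans (∑-distrib-+ n (λ i → u * + i) (λ _ → v)) (cong₂ _+_ (∑-*ˡ n u (λ i → + i)) (∑-const n v))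

  -- The solver cannot unfold a local F, so the step lemmas below spell out F (1 + x) - F x.
  ∑-square-⊔-max : ∀ n → + 6 * ∑[ j < n ] ∑[ i < n ] (+ (i ⊔ j)) ≡ + 4 * (+ n * + n * + n) - + 3 * (+ n * + n) - + n
  ∑-square-⊔-max n = trans (cong (_*_ (+ 6)) (∑-square-⊔ n (λ m _ _ → + m))) (∑-telescope F (+ 6) _ refl step n)
    where
    F : ℤ → ℤ
    F x = + 4 * (x * x * x) - + 3 * (x * x) - x
    lemma : ∀ x → + 6 * (x * x + x * x + x)
                  ≡ + 4 * ((+ 1 + x) * (+ 1 + x) * (+ 1 + x)) - + 3 * ((+ 1 + x) * (+ 1 + x)) - (+ 1 + x)
                    - (+ 4 * (x * x * x) - + 3 * (x * x) - x)
    lemma = solve-∀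
    step : ∀ m → + 6 * gnomon (λ m _ _ → + m) m ≡ F (+ suc m) - F (+ m)
    step m = trans (cong (λ s → + 6 * (s + s + + m)) (∑-const m (+ m))) (lemma (+ m))

  ∑-square-⊔-max² : ∀ n → + 6 * ∑[ j < n ] ∑[ i < n ] (+ (i ⊔ j) * + (i ⊔ j))
                    ≡ + 3 * (+ n * + n * (+ n - + 1) * (+ n - + 1)) + + n * (+ n - + 1) * (+ 2 * + n - + 1)
  ∑-square-⊔-max² n = trans (cong (_*_ (+ 6)) (∑-square-⊔ n (λ m _ _ → + m * + m))) (∑-telescope F (+ 6) _ refl step n)
    where
    F : ℤ → ℤ
    F x = + 3 * (x * x * (x - + 1) * (x - + 1)) + x * (x - + 1) * (+ 2 * x - + 1)
    lemma : ∀ x → + 6 * (x * (x * x) + x * (x * x) + x * x)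
                  ≡ + 3 * ((+ 1 + x) * (+ 1 + x) * (+ 1 + x - + 1) * (+ 1 + x - + 1)) + (+ 1 + x) * (+ 1 + x - + 1) * (+ 2 * (+ 1 + x) - + 1)
                    - (+ 3 * (x * x * (x - + 1) * (x - + 1)) + x * (x - + 1) * (+ 2 * x - + 1))
    lemma = solve-∀
    step : ∀ m → + 6 * gnomon (λ m _ _ → + m * + m) m ≡ F (+ suc m) - F (+ m)
    step m = trans (cong (λ s → + 6 * (s + s + + m * + m)) (∑-const m (+ m * + m))) (lemma (+ m))

  ∑-square-⊔-max-weighted : ∀ n c → + 24 * ∑[ j < n ] ∑[ i < n ] (+ (i ⊔ j) * (+ i + + j * c))
                            ≡ (+ 1 + c) * (+ 9 * (+ n * + n * (+ n - + 1) * (+ n - + 1)) + + 2 * (+ n * (+ n - + 1) * (+ 2 * + n - + 1)))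
  ∑-square-⊔-max-weighted n c = trans (cong (_*_ (+ 24)) (∑-square-⊔ n g)) (∑-telescope F (+ 24) _ (*-zeroʳ (+ 1 + c)) step n)
    where
    g : ℕ → ℕ → ℕ → ℤ
    g m i j = + m * (+ i + + j * c)
    F : ℤ → ℤ
    F x = (+ 1 + c) * (+ 9 * (x * x * (x - + 1) * (x - + 1)) + + 2 * (x * (x - + 1) * (+ 2 * x - + 1)))
    lemma : ∀ x s → + 2 * s ≡ x * (x - + 1) →
            + 24 * (x * s + x * (x * (x * c)) + ((x * c) * s + x * (x * x)) + x * (x + x * c)) ≡ F (+ 1 + x) - F x
    lemma x s 2s≡ = begin
      + 24 * (x * s + x * (x * (x * c)) + ((x * c) * s + x * (x * x)) + x * (x + x * c))
        ≡⟨ expand c x s ⟩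
      + 12 * x * (+ 1 + c) * (+ 2 * s) + + 24 * ((+ 1 + c) * (x * x * x + x * x))
        ≡⟨ cong (λ u → + 12 * x * (+ 1 + c) * u + + 24 * ((+ 1 + c) * (x * x * x + x * x))) 2s≡ ⟩
      + 12 * x * (+ 1 + c) * (x * (x - + 1)) + + 24 * ((+ 1 + c) * (x * x * x + x * x))
        ≡⟨ telescoped c x ⟩
      F (+ 1 + x) - F x
        ∎
      where
      open ≡-Reasoning
      expand : ∀ c x s → + 24 * (x * s + x * (x * (x * c)) + ((x * c) * s + x * (x * x)) + x * (x + x * c))
                       ≡ + 12 * x * (+ 1 + c) * (+ 2 * s) + + 24 * ((+ 1 + c) * (x * x * x + x * x))
      expand = solve-∀
      telescoped : ∀ c x → + 12 * x * (+ 1 + c) * (x * (x - + 1)) + + 24 * ((+ 1 + c) * (x * x * x + x * x))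
                         ≡ (+ 1 + c) * (+ 9 * ((+ 1 + x) * (+ 1 + x) * (+ 1 + x - + 1) * (+ 1 + x - + 1))
                                        + + 2 * ((+ 1 + x) * (+ 1 + x - + 1) * (+ 2 * (+ 1 + x) - + 1)))
                           - (+ 1 + c) * (+ 9 * (x * x * (x - + 1) * (x - + 1)) + + 2 * (x * (x - + 1) * (+ 2 * x - + 1)))
      telescoped = solve-∀
    step : ∀ m → + 24 * gnomon g m ≡ F (+ suc m) - F (+ m)
    step m = trans (cong (λ u → + 24 * u) (cong₂ (λ r k → r + k + g m m m) row col)) (lemma (+ m) (∑[ i < m ] (+ i)) (∑-id m))
      where
      row : ∑[ i < m ] g m i m ≡ + m * ∑[ i < m ] (+ i) + + m * (+ m * (+ m * c))
      row = trans (∑-cong m (λ i _ → *-distribˡ-+ (+ m) (+ i) (+ m * c))) (∑-affine m (+ m) (+ m * (+ m * c)))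
      col : ∑[ j < m ] g m m j ≡ (+ m * c) * ∑[ i < m ] (+ i) + + m * (+ m * + m)
      col = trans (∑-cong m (λ j _ → rearrange c (+ m) (+ j))) (∑-affine m (+ m * c) (+ m * + m))
        where
        rearrange : ∀ c x y → x * (x + y * c) ≡ (x * c) * y + x * x
        rearrange = solve-∀

  sum-arithmetic : ∀ n r k → + 2 * + sum (applyDownFrom (λ l → l ℕ.* n ℕ.+ r) k) ≡ + n * + k * (+ k - + 1) + + 2 * + k * + r
  sum-arithmetic n r zero    = base (+ n) (+ r)
    where
    base : ∀ n r → + 0 ≡ n * + 0 * (+ 0 - + 1) + + 2 * + 0 * r
    base = solve-∀
  sum-arithmetic n r (suc k) = begin
    + 2 * (+ (k ℕ.* n) + + r + + s)               ≡⟨ cong (λ x → + 2 * (x + + r + + s)) (pos-* k n) ⟩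
    + 2 * (+ k * + n + + r + + s)                 ≡⟨ *-distribˡ-+ (+ 2) (+ k * + n + + r) (+ s) ⟩
    + 2 * (+ k * + n + + r) + + 2 * + s           ≡⟨ cong (_+_ (+ 2 * (+ k * + n + + r))) (sum-arithmetic n r k) ⟩
    + 2 * (+ k * + n + + r) + (+ n * + k * (+ k - + 1) + + 2 * + k * + r)
                                                  ≡⟨ step (+ n) (+ r) (+ k) ⟩
    + n * (+ 1 + + k) * (+ 1 + + k - + 1) + + 2 * (+ 1 + + k) * + r ∎
    where
    open ≡-Reasoning
    s : ℕ
    s = sum (applyDownFrom (λ l → l ℕ.* n ℕ.+ r) k)
    step : ∀ n r k → + 2 * (k * n + r) + (n * k * (k - + 1) + + 2 * k * r)
                     ≡ n * (+ 1 + k) * (+ 1 + k - + 1) + + 2 * (+ 1 + k) * r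
    step = solve-∀

  pos-^ : ∀ m n → + m ^ n ≡ (+ m) ^′ n
  pos-^ m zero          = refl
  pos-^ m (suc zero)    = cong +_ (ℕₚ.*-identityʳ m)
  pos-^ m (suc (suc n)) = trans (pos-* m (m ^ suc n)) (trans (cong (_*_ (+ m)) (pos-^ m (suc n))) (*-comm (+ m) _))

open IntegerSums

module NatArithmetic where
  open import Data.Nat using (_+_; _*_; _∸_; _⊔_; _⊓_)
  open import Data.Nat.Properties
  open import Data.Nat.DivMod using (%-distribˡ-*; m%n%n≡m%n; [m+kn]%n≡m%n; [m+n]%n≡m%n)
  open import Data.Nat.Divisibility using (∣-trans)
  open import Data.Nat.Coprimality using (coprime-divisor; coprime-Bézout)
  open import Data.Nat.GCD using (module Bézout)
  import Data.Nat.Tactic.RingSolver as ℕ-Solver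

  coprime-* : ∀ {m n o} → Coprime m n → Coprime o n → Coprime (m * o) n
  coprime-* {m} {n} {o} m⊥n o⊥n (i∣mo , i∣n) = o⊥n (coprime-divisor i⊥m i∣mo , i∣n)
    where
    i⊥m : Coprime _ m
    i⊥m (j∣i , j∣m) = m⊥n (j∣m , ∣-trans j∣i i∣n)

  [m*[n%o]]%o≡[m*n]%o : ∀ m n o .{{_ : NonZero o}} → (m * (n % o)) % o ≡ (m * n) % o
  [m*[n%o]]%o≡[m*n]%o m n o = begin
    (m * (n % o)) % o            ≡⟨ %-distribˡ-* m (n % o) o ⟩
    ((m % o) * (n % o % o)) % o  ≡⟨ cong (λ x → ((m % o) * x) % o) (m%n%n≡m%n n o) ⟩
    ((m % o) * (n % o)) % o      ≡⟨ %-distribˡ-* m n o ⟨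
    (m * n) % o                  ∎
    where open ≡-Reasoning

  modular-inverse : ∀ {m n} .{{_ : NonZero n}} → Coprime m n → Σ ℕ λ e → (m * e) % n ≡ 1 % n
  modular-inverse {m} {n@(suc n-1)} m⊥n with coprime-Bézout m⊥n
  ... | Bézout.+- x y eq = x , (begin
    (m * x) % n       ≡⟨ cong (_% n) (trans (*-comm m x) (sym eq)) ⟩
    (1 + y * n) % n   ≡⟨ [m+kn]%n≡m%n 1 y n ⟩
    1 % n             ∎)
    where open ≡-Reasoning
  -- From 1 + x m ≡ y n, the product m (x (n - 1)) equals 1 modulo n.
  ... | Bézout.-+ x y eq = x * n-1 , (begin
    (m * (x * n-1)) % n                ≡⟨ [m+n]%n≡m%n (m * (x * n-1)) n ⟨
    (m * (x * n-1) + n) % n            ≡⟨ cong (_% n) (lemma m x n-1) ⟩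
    ((1 + x * m) * n-1 + 1) % n        ≡⟨ cong (λ k → (k * n-1 + 1) % n) eq ⟩
    (y * n * n-1 + 1) % n              ≡⟨ cong (_% n) (lemma′ y n n-1) ⟩
    (1 + (y * n-1) * n) % n            ≡⟨ [m+kn]%n≡m%n 1 (y * n-1) n ⟩
    1 % n                              ∎)
    where
    open ≡-Reasoning
    lemma : ∀ m x k → m * (x * k) + suc k ≡ (1 + x * m) * k + 1
    lemma = ℕ-Solver.solve-∀
    lemma′ : ∀ y n k → y * n * k + 1 ≡ 1 + (y * k) * n
    lemma′ = ℕ-Solver.solve-∀

  inverse-cancel : ∀ {d e n} .{{_ : NonZero n}} → (d * e) % n ≡ 1 % n → ∀ m → (d * (e * m % n)) % n ≡ m % n
  inverse-cancel {d} {e} {n} de≡1 m = begin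
    (d * (e * m % n)) % n        ≡⟨ [m*[n%o]]%o≡[m*n]%o d (e * m) n ⟩
    (d * (e * m)) % n            ≡⟨ cong (_% n) (*-assoc d e m) ⟨
    (d * e * m) % n              ≡⟨ %-distribˡ-* (d * e) m n ⟩
    ((d * e) % n * (m % n)) % n  ≡⟨ cong (λ x → (x * (m % n)) % n) de≡1 ⟩
    (1 % n * (m % n)) % n        ≡⟨ %-distribˡ-* 1 m n ⟨
    (1 * m) % n                  ≡⟨ cong (_% n) (*-identityˡ m) ⟩
    m % n                        ∎
    where open ≡-Reasoning

  m∸n+m⊓n≡m : ∀ m n → m ∸ n + m ⊓ n ≡ m
  m∸n+m⊓n≡m m n = trans (+-comm (m ∸ n) _) (trans (cong (_+ (m ∸ n)) (⊓-comm m n)) (m⊓n+n∸m≡n n m))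

  m∸n+[n∸m]+m⊓n≡m⊔n : ∀ m n → m ∸ n + (n ∸ m) + m ⊓ n ≡ m ⊔ n
  m∸n+[n∸m]+m⊓n≡m⊔n zero    zero    = refl
  m∸n+[n∸m]+m⊓n≡m⊔n zero    (suc n) = +-identityʳ (suc n)
  m∸n+[n∸m]+m⊓n≡m⊔n (suc m) zero     = trans (+-identityʳ _) (+-identityʳ _)
  m∸n+[n∸m]+m⊓n≡m⊔n (suc m) (suc n) = trans (+-suc _ _) (cong suc (m∸n+[n∸m]+m⊓n≡m⊔n m n))

open NatArithmetic

-- Apéry elements indexed by t < N rather than by residue: t ↦ w t % N is a bijection onto
-- the residues modulo N, with inverse τ.
module Apéry
  (Rep : ℕ → Set) (N : ℕ) .{{_ : NonZero N}} (w τ : ℕ → ℕ)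
  (τ<N : ∀ r → τ r ℕ.< N)
  (w∘τ : ∀ r → w (τ r) % N ≡ r % N)
  (τ∘w : ∀ t → t ℕ.< N → τ (w t % N) ≡ t)
  (rep-w+ : ∀ t k → Rep (w t ℕ.+ k ℕ.* N))
  (w-minimal : ∀ t m → t ℕ.< N → Rep m → m % N ≡ w t % N → w t ℕ.≤ m)
  where
  open import Data.Nat using (>-nonZero)
  open import Data.Nat.DivMod using (m≥n⇒m/n>0; m%n<n; m≡m%n+[m/n]*n; [m+kn]%n≡m%n; m%n%n≡m%n; m<n⇒m%n≡m)
  open import Data.Nat.ListAction.Properties using (sum-++)
  open import Data.List.Properties using (length-++; length-applyDownFrom)
  open import Data.List.Membership.Propositional.Properties using (∈-++⁻; ∈-++⁺ˡ; ∈-++⁺ʳ; ∈-applyDownFrom⁺; ∈-applyDownFrom⁻)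
  open import Data.List.Relation.Unary.Unique.Propositional using (Unique)
  import Data.List.Relation.Unary.Unique.Propositional.Properties as Unique
  open import Data.List.Relation.Unary.AllPairs using ([])
  open import Data.Sum using (inj₁; inj₂)
  open import Data.Empty using (⊥-elim)
  open import Function.Bundles using (_⇔_; mk⇔)
  open import Relation.Nullary using (¬_; yes; no)

  module Gaps where
    open import Data.Nat using (_+_; _*_; _∸_; _<_; _≤_)
    open import Data.Nat.Properties
    import Data.Nat.Tactic.RingSolver as ℕ-Solver

    residue level : ℕ → ℕ
    residue t = w t % N
    level t = w t / N

    w≡ : ∀ t → w t ≡ level t * N + residue t
    w≡ t = trans (m≡m%n+[m/n]*n (w t) N) (+-comm (residue t) (level t * N))

    residue-injective : ∀ {t t′} → t < N → t′ < N → residue t ≡ residue t′ → t ≡ t′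
    residue-injective {t} {t′} t<N t′<N eq = trans (sym (τ∘w t t<N)) (trans (cong τ eq) (τ∘w t′ t′<N))

    residue-%N : ∀ l t → (l * N + residue t) % N ≡ residue t
    residue-%N l t = begin
      (l * N + residue t) % N   ≡⟨ cong (_% N) (+-comm (l * N) (residue t)) ⟩
      (residue t + l * N) % N   ≡⟨ [m+kn]%n≡m%n (residue t) l N ⟩
      residue t % N             ≡⟨ m%n%n≡m%n (w t) N ⟩
      residue t                 ∎
      where open ≡-Reasoning

    gapsOf : ℕ → List ℕ
    gapsOf t = applyDownFrom (λ l → l * N + residue t) (level t)

    gapsBelow : ℕ → List ℕ
    gapsBelow zero    = []
    gapsBelow (suc n) = gapsBelow n ++ gapsOf n

    gaps : List ℕ
    gaps = gapsBelow N

    ∈-gapsBelow⁻ : ∀ n {m} → m ∈ gapsBelow n → Σ ℕ λ t → t < n × Σ ℕ λ l → l < level t × m ≡ l * N + residue t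
    ∈-gapsBelow⁻ (suc n) m∈ with ∈-++⁻ (gapsBelow n) m∈
    ... | inj₁ m∈below  with t , t<n , rest ← ∈-gapsBelow⁻ n m∈below = t , m<n⇒m<1+n t<n , rest
    ... | inj₂ m∈gapsOf with l , l<level , refl ← ∈-applyDownFrom⁻ _ m∈gapsOf = n , ≤-refl , l , l<level , refl

    ∈-gapsBelow⁺ : ∀ n {t l} → t < n → l < level t → l * N + residue t ∈ gapsBelow n
    ∈-gapsBelow⁺ (suc n) {t} t<1+n l<level with t ℕ.≟ n
    ... | yes refl = ∈-++⁺ʳ (gapsBelow n) (∈-applyDownFrom⁺ _ l<level)
    ... | no t≢n   = ∈-++⁺ˡ (∈-gapsBelow⁺ n (≤∧≢⇒< (≤-pred t<1+n) t≢n) l<level)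

    gapsOf-unique : ∀ t → Unique (gapsOf t)
    gapsOf-unique t = Unique.applyDownFrom⁺₁ _ (level t) λ j<i _ eq →
      <-irrefl (sym (*-cancelʳ-≡ _ _ N (+-cancelʳ-≡ _ _ _ eq))) j<i

    gapsBelow-unique : ∀ n → n ≤ N → Unique (gapsBelow n)
    gapsBelow-unique zero    _     = []
    gapsBelow-unique (suc n) 1+n≤N = Unique.++⁺ (gapsBelow-unique n (<⇒≤ 1+n≤N)) (gapsOf-unique n) disjoint
      where
      disjoint : ∀ {m} → ¬ (m ∈ gapsBelow n × m ∈ gapsOf n)
      disjoint (m∈below , m∈gapsOf)
        with l , _ , refl ← ∈-applyDownFrom⁻ _ m∈gapsOf
           | t , t<n , l′ , _ , eq ← ∈-gapsBelow⁻ n m∈below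
        = <-irrefl (residue-injective (<-trans t<n 1+n≤N) 1+n≤N same-residue) t<n
        where
        same-residue : residue t ≡ residue n
        same-residue = trans (sym (residue-%N l′ t)) (trans (cong (_% N) (sym eq)) (residue-%N l n))

    gaps-unique : Unique gaps
    gaps-unique = gapsBelow-unique N ≤-refl

    below-level⇒¬rep : ∀ t l → t < N → l < level t → ¬ Rep (l * N + residue t)
    below-level⇒¬rep t l t<N l<level rep = <-irrefl refl (begin-strict
      w t                   ≤⟨ w-minimal t _ t<N rep (residue-%N l t) ⟩
      l * N + residue t     <⟨ +-monoˡ-< (residue t) (*-monoˡ-< N l<level) ⟩
      level t * N + residue t ≡⟨ w≡ t ⟨
      w t                   ∎)
      where open ≤-Reasoning

    ∈-gaps⇔¬rep : ∀ m → (m ∈ gaps) ⇔ (¬ Rep m)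
    ∈-gaps⇔¬rep m = mk⇔ to from
      where
      to : m ∈ gaps → ¬ Rep m
      to m∈ with t , t<N , l , l<level , refl ← ∈-gapsBelow⁻ N m∈ = below-level⇒¬rep t l t<N l<level
      t : ℕ
      t = τ (m % N)
      residue-t : residue t ≡ m % N
      residue-t = trans (w∘τ (m % N)) (m%n%n≡m%n m N)
      m≡ : m ≡ m / N * N + residue t
      m≡ = trans (m≡m%n+[m/n]*n m N) (trans (+-comm (m % N) _) (cong (_+_ (m / N * N)) (sym residue-t)))
      from : ¬ Rep m → m ∈ gaps
      from ¬rep with m / N <? level t
      ... | yes below = subst (_∈ gaps) (sym m≡) (∈-gapsBelow⁺ N (τ<N (m % N)) below)
      ... | no  above = ⊥-elim (¬rep (subst Rep w+k*N≡m (rep-w+ t k)))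
        where
        k : ℕ
        k = m / N ∸ level t
        w+k*N≡m : w t + k * N ≡ m
        w+k*N≡m = begin
          w t + k * N                          ≡⟨ cong (_+ k * N) (w≡ t) ⟩
          level t * N + residue t + k * N      ≡⟨ shift (level t) N (residue t) k ⟩
          (level t + k) * N + residue t        ≡⟨ cong (λ x → x * N + residue t) (m+[n∸m]≡n (≮⇒≥ above)) ⟩
          m / N * N + residue t                ≡⟨ m≡ ⟨
          m                                    ∎
          where
          open ≡-Reasoning
          shift : ∀ x n r k → x * n + r + k * n ≡ (x + k) * n + r
          shift = ℕ-Solver.solve-∀

    gaps-max : ∀ T → T < N → (∀ t → t < N → w t ≤ w T) → N ≤ w T →
               (w T ∸ N ∈ gaps) × All (_≤ w T ∸ N) gaps
    gaps-max T T<N w≤wT N≤wT = wT∸N∈gaps , All.tabulate below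
      where
      open ≤-Reasoning
      next-level : ∀ l t → l * N + residue t + N ≡ suc l * N + residue t
      next-level l t = lemma l N (residue t)
        where
        lemma : ∀ l n r → l * n + r + n ≡ (1 + l) * n + r
        lemma = ℕ-Solver.solve-∀
      top-gap : ∀ l → suc l ≡ level T → w T ∸ N ∈ gaps
      top-gap l 1+l≡level = subst (_∈ gaps) (sym wT∸N≡) (∈-gapsBelow⁺ N T<N (≤-reflexive 1+l≡level))
        where
        wT∸N≡ : w T ∸ N ≡ l * N + residue T
        wT∸N≡ = begin-equality
          w T ∸ N                        ≡⟨ cong (_∸ N) (w≡ T) ⟩
          level T * N + residue T ∸ N    ≡⟨ cong (λ k → k * N + residue T ∸ N) 1+l≡level ⟨
          suc l * N + residue T ∸ N      ≡⟨ cong (_∸ N) (next-level l T) ⟨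
          l * N + residue T + N ∸ N      ≡⟨ m+n∸n≡m _ N ⟩
          l * N + residue T              ∎
      wT∸N∈gaps : w T ∸ N ∈ gaps
      wT∸N∈gaps = top-gap (ℕ.pred (level T)) (suc-pred (level T) {{>-nonZero (m≥n⇒m/n>0 N≤wT)}})
      below : ∀ {m} → m ∈ gaps → m ≤ w T ∸ N
      below m∈ with t , t<N , l , l<level , refl ← ∈-gapsBelow⁻ N m∈ = m+n≤o⇒m≤o∸n _ (begin
        l * N + residue t + N       ≡⟨ next-level l t ⟩
        suc l * N + residue t       ≤⟨ +-monoˡ-≤ (residue t) (*-monoˡ-≤ N l<level) ⟩
        level t * N + residue t     ≡⟨ w≡ t ⟨
        w t                         ≤⟨ w≤wT t t<N ⟩
        w T                         ∎)

  open Gaps public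

  module Counting where
    open import Data.Integer using (ℤ; +_; _+_; _-_; _*_)
    open import Data.Integer.Properties using (pos-*)
    open import Data.Integer.Tactic.RingSolver using (solve-∀)

    ∑-residue : ∀ f → ∑[ t < N ] f (residue t) ≡ ∑ N f
    ∑-residue f = ∑-permute N f residue τ (λ t _ → m%n<n (w t) N) (λ r _ → τ<N r)
                            (λ r r<N → trans (w∘τ r) (m<n⇒m%n≡m r<N)) τ∘w

    w≡ℤ : ∀ t → + w t ≡ + level t * + N + + residue t
    w≡ℤ t = trans (cong +_ (w≡ t)) (cong (_+ + residue t) (pos-* (level t) N))

    length-gapsBelow : ∀ n → + length (gapsBelow n) ≡ ∑[ t < n ] (+ level t)
    length-gapsBelow zero    = refl
    length-gapsBelow (suc n) = begin
      + length (gapsBelow n ++ gapsOf n)            ≡⟨ cong +_ (length-++ (gapsBelow n)) ⟩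
      + length (gapsBelow n) + + length (gapsOf n)  ≡⟨ cong₂ _+_ (length-gapsBelow n) (cong +_ (length-applyDownFrom _ (level n))) ⟩
      ∑[ t < suc n ] (+ level t)                    ∎
      where open ≡-Reasoning

    sum-gapsBelow : ∀ n → + sum (gapsBelow n) ≡ ∑[ t < n ] (+ sum (gapsOf t))
    sum-gapsBelow zero    = refl
    sum-gapsBelow (suc n) = trans (cong +_ (sum-++ (gapsBelow n) (gapsOf n))) (cong (_+ + sum (gapsOf n)) (sum-gapsBelow n))

    selmer-length : + N * + length gaps ≡ ∑[ t < N ] (+ w t) - ∑[ t < N ] (+ t)
    selmer-length = begin
      + N * + length gaps                            ≡⟨ cong (_*_ (+ N)) (length-gapsBelow N) ⟩
      + N * ∑[ t < N ] (+ level t)                   ≡⟨ ∑-*ˡ N (+ N) (λ t → + level t) ⟨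
      ∑[ t < N ] (+ N * + level t)                   ≡⟨ ∑-cong N (λ t _ → N*level t) ⟩
      ∑[ t < N ] (+ w t - + residue t)               ≡⟨ ∑-distrib-- N (λ t → + w t) (λ t → + residue t) ⟩
      ∑[ t < N ] (+ w t) - ∑[ t < N ] (+ residue t)  ≡⟨ cong (∑[ t < N ] (+ w t) -_) (∑-residue (λ r → + r)) ⟩
      ∑[ t < N ] (+ w t) - ∑[ t < N ] (+ t)          ∎
      where
      open ≡-Reasoning
      lemma : ∀ k n r → n * k ≡ k * n + r - r
      lemma = solve-∀
      N*level : ∀ t → + N * + level t ≡ + w t - + residue t
      N*level t = trans (lemma (+ level t) (+ N) (+ residue t)) (cong (_- + residue t) (sym (w≡ℤ t)))

    sum-gapsOf : ∀ t → + 2 * + N * + sum (gapsOf t) ≡ + w t * + w t - + residue t * + residue t - + N * (+ w t - + residue t)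
    sum-gapsOf t = begin
      + 2 * + N * + sum (gapsOf t)         ≡⟨ swap (+ N) (+ sum (gapsOf t)) ⟩
      + N * (+ 2 * + sum (gapsOf t))       ≡⟨ cong (_*_ (+ N)) (sum-arithmetic N (residue t) (level t)) ⟩
      + N * (+ N * K * (K - + 1) + + 2 * K * R)  ≡⟨ expand (+ N) K R ⟩
      (K * + N + R) * (K * + N + R) - R * R - + N * (K * + N + R - R)
                                           ≡⟨ cong (λ W → W * W - R * R - + N * (W - R)) (w≡ℤ t) ⟨
      + w t * + w t - R * R - + N * (+ w t - R) ∎
      where
      open ≡-Reasoning
      K R : ℤ
      K = + level t
      R = + residue t
      swap : ∀ n s → + 2 * n * s ≡ n * (+ 2 * s)
      swap = solve-∀
      expand : ∀ n k r → n * (n * k * (k - + 1) + + 2 * k * r) ≡ (k * n + r) * (k * n + r) - r * r - n * (k * n + r - r)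
      expand = solve-∀

    selmer-sum : + 2 * + N * + sum gaps ≡ ∑[ t < N ] (+ w t * + w t) - ∑[ t < N ] (+ t * + t) - + N * (∑[ t < N ] (+ w t) - ∑[ t < N ] (+ t))
    selmer-sum = begin
      + 2 * + N * + sum gaps
        ≡⟨ cong (_*_ (+ 2 * + N)) (sum-gapsBelow N) ⟩
      + 2 * + N * ∑[ t < N ] (+ sum (gapsOf t))
        ≡⟨ ∑-*ˡ N (+ 2 * + N) (λ t → + sum (gapsOf t)) ⟨
      ∑[ t < N ] (+ 2 * + N * + sum (gapsOf t))
        ≡⟨ ∑-cong N (λ t _ → sum-gapsOf t) ⟩
      ∑[ t < N ] (W t * W t - R t * R t - + N * (W t - R t))
        ≡⟨ ∑-distrib-- N (λ t → W t * W t - R t * R t) (λ t → + N * (W t - R t)) ⟩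
      ∑[ t < N ] (W t * W t - R t * R t) - ∑[ t < N ] (+ N * (W t - R t))
        ≡⟨ cong₂ _-_ (∑-distrib-- N (λ t → W t * W t) (λ t → R t * R t))
                     (trans (∑-*ˡ N (+ N) (λ t → W t - R t)) (cong (_*_ (+ N)) (∑-distrib-- N W R))) ⟩
      ∑[ t < N ] (W t * W t) - ∑[ t < N ] (R t * R t) - + N * (∑ N W - ∑ N R)
        ≡⟨ cong₂ (λ x y → ∑[ t < N ] (W t * W t) - x - + N * (∑ N W - y)) (∑-residue (λ r → + r * + r)) (∑-residue (λ r → + r)) ⟩
      ∑[ t < N ] (W t * W t) - ∑[ t < N ] (+ t * + t) - + N * (∑ N W - ∑[ t < N ] (+ t))
        ∎
      where
      open ≡-Reasoning
      W R : ℕ → ℤ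
      W t = + w t
      R t = + residue t

module Semigroup (a′ h d : ℕ) (a⊥d : Coprime (suc a′) d) where
  open import Data.Nat using (_+_; _*_; _∸_; _⊔_; _⊓_; _<_; _≤_)
  open import Data.Nat.Properties
  open import Data.Nat.DivMod using (m%n<n; m<n⇒m%n≡m; m<n⇒m/n≡0; m≡m%n+[m/n]*n; [m+kn]%n≡m%n; %-remove-+ˡ; +-distrib-/-∣ˡ; m*n/n≡m; m<n*o⇒m/o<n)
  open import Data.Nat.Divisibility using (n∣m*n)
  import Data.Nat.Tactic.RingSolver as ℕ-Solver
  import Data.Vec as Vec
  open Vec using ([]; _∷_)
  open import Relation.Nullary using (yes; no)

  a N : ℕ
  a = suc a′
  N = a * a

  vecA-combination : ∀ x₀ x₁ x₂ x₃ →
    Vec.sum (Vec.zipWith _*_ (vecA a h d) (x₀ ∷ x₁ ∷ x₂ ∷ x₃ ∷ []))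
    ≡ (x₀ + h * (x₁ + x₂ + x₃)) * N + d * ((x₁ + x₃) + (x₂ + x₃) * a)
  vecA-combination = polynomial a h d
    where
    polynomial : ∀ a h d x₀ x₁ x₂ x₃ →
      a * a * x₀ + ((h * (a * a) + d) * x₁ + ((h * (a * a) + a * d) * x₂ + ((h * (a * a) + (a + 1) * d) * x₃ + 0)))
      ≡ (x₀ + h * (x₁ + x₂ + x₃)) * (a * a) + d * ((x₁ + x₃) + (x₂ + x₃) * a)
    polynomial = ℕ-Solver.solve-∀

  lowDigit highDigit maxDigit : ℕ → ℕ
  lowDigit t = t % a
  highDigit t = t / a
  maxDigit t = lowDigit t ⊔ highDigit t

  digits : ∀ t → t ≡ lowDigit t + highDigit t * a
  digits t = m≡m%n+[m/n]*n t a

  maxDigit<a : ∀ {t} → t < N → maxDigit t < a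
  maxDigit<a {t} t<N = ⊔-lub (m%n<n t a) (m<n*o⇒m/o<n t<N)

  maxDigit-pair : ∀ i j → i < a → maxDigit (j * a + i) ≡ i ⊔ j
  maxDigit-pair i j i<a = cong₂ _⊔_ low high
    where
    low : (j * a + i) % a ≡ i
    low = trans (cong (_% a) (+-comm (j * a) i)) (trans ([m+kn]%n≡m%n i j a) (m<n⇒m%n≡m i<a))
    high : (j * a + i) / a ≡ j
    high = trans (+-distrib-/-∣ˡ i (n∣m*n j)) (trans (cong₂ _+_ (m*n/n≡m j a) (m<n⇒m/n≡0 i<a)) (+-identityʳ j))

  -- Reaching the class of d t costs at least maxDigit t of the last three generators (maxDigit-minimal).
  w : ℕ → ℕ
  w t = h * maxDigit t * N + d * t

  rep-w+ : ∀ t k → Representable (vecA a h d) (w t + k * N)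
  rep-w+ t k = (k ∷ i ∸ j ∷ j ∸ i ∷ i ⊓ j ∷ []) , (begin
    Vec.sum (Vec.zipWith _*_ (vecA a h d) (k ∷ i ∸ j ∷ j ∸ i ∷ i ⊓ j ∷ []))
      ≡⟨ vecA-combination k (i ∸ j) (j ∸ i) (i ⊓ j) ⟩
    (k + h * (i ∸ j + (j ∸ i) + i ⊓ j)) * N + d * ((i ∸ j + i ⊓ j) + (j ∸ i + i ⊓ j) * a)
      ≡⟨ cong₂ (λ c s → (k + h * c) * N + d * s) (m∸n+[n∸m]+m⊓n≡m⊔n i j) (cong₂ (λ u v → u + v * a) (m∸n+m⊓n≡m i j) (trans (cong (j ∸ i +_) (⊓-comm i j)) (m∸n+m⊓n≡m j i))) ⟩
    (k + h * maxDigit t) * N + d * (i + j * a)                        ≡⟨ cong (λ s → (k + h * maxDigit t) * N + d * s) (digits t) ⟨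
    (k + h * maxDigit t) * N + d * t                                  ≡⟨ lemma k (h * maxDigit t) N (d * t) ⟩
    w t + k * N                                                       ∎)
    where
    open ≡-Reasoning
    i j : ℕ
    i = lowDigit t
    j = highDigit t
    lemma : ∀ k c n s → (k + c) * n + s ≡ c * n + s + k * n
    lemma = ℕ-Solver.solve-∀

  maxDigit-minimal : ∀ {t u v q} → t < N → u + v * a ≡ t + q * N → maxDigit t ≤ u ⊔ v
  maxDigit-minimal {t} {u} {v} {q} t<N eq with a ≤? u
  ... | yes a≤u = ≤-trans (<⇒≤ (<-≤-trans (maxDigit<a t<N) a≤u)) (m≤m⊔n u v)
  ... | no  a≰u = ⊔-mono-≤ (≤-reflexive low≡u) high≤v
    where
    open ≤-Reasoning
    low≡u : lowDigit t ≡ u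
    low≡u = begin-equality
      t % a                  ≡⟨ [m+kn]%n≡m%n t (q * a) a ⟨
      (t + q * a * a) % a    ≡⟨ cong (λ x → (t + x) % a) (*-assoc q a a) ⟩
      (t + q * N) % a        ≡⟨ cong (_% a) eq ⟨
      (u + v * a) % a        ≡⟨ [m+kn]%n≡m%n u v a ⟩
      u % a                  ≡⟨ m<n⇒m%n≡m (≰⇒> a≰u) ⟩
      u                      ∎
    high≤v : highDigit t ≤ v
    high≤v = *-cancelʳ-≤ _ _ a (+-cancelˡ-≤ u _ _ (begin
      u + highDigit t * a               ≡⟨ cong (_+ highDigit t * a) low≡u ⟨
      lowDigit t + highDigit t * a      ≡⟨ digits t ⟨
      t                                 ≤⟨ m≤m+n t (q * N) ⟩
      t + q * N                         ≡⟨ eq ⟨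
      u + v * a                         ∎))

  d⊥N : Coprime d N
  d⊥N = Coprimality.sym (coprime-* a⊥d a⊥d)

  e : ℕ
  e = proj₁ (modular-inverse d⊥N)

  τ : ℕ → ℕ
  τ r = (e * r) % N

  τ<N : ∀ r → τ r < N
  τ<N r = m%n<n (e * r) N

  de≡1 : (d * e) % N ≡ 1 % N
  de≡1 = proj₂ (modular-inverse d⊥N)

  τ-cancel : ∀ x → τ ((d * x) % N) ≡ x % N
  τ-cancel = inverse-cancel {e} {d} {N} (trans (cong (_% N) (*-comm e d)) de≡1)

  w%N : ∀ t → w t % N ≡ (d * t) % N
  w%N t = %-remove-+ˡ (d * t) (n∣m*n (h * maxDigit t))

  w∘τ : ∀ r → w (τ r) % N ≡ r % N
  w∘τ r = trans (w%N (τ r)) (inverse-cancel {d} {e} {N} de≡1 r)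

  τ∘w : ∀ t → t < N → τ (w t % N) ≡ t
  τ∘w t t<N = trans (cong τ (w%N t)) (trans (τ-cancel t) (m<n⇒m%n≡m t<N))

  w-minimal : ∀ t m → t < N → Representable (vecA a h d) m → m % N ≡ w t % N → w t ≤ m
  w-minimal t m t<N ((x₀ ∷ x₁ ∷ x₂ ∷ x₃ ∷ []) , eq) m≡wt = begin
    h * maxDigit t * N + d * t                        ≤⟨ +-monoˡ-≤ (d * t) (*-monoˡ-≤ N (*-monoʳ-≤ h maxDigit≤c)) ⟩
    h * c * N + d * t                                 ≤⟨ m≤m+n _ (x₀ * N + d * q * N) ⟩
    h * c * N + d * t + (x₀ * N + d * q * N)          ≡⟨ lemma h c N d t x₀ q ⟩
    (x₀ + h * c) * N + d * (t + q * N)                ≡⟨ cong (λ s → (x₀ + h * c) * N + d * s) S≡ ⟨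
    (x₀ + h * c) * N + d * S                          ≡⟨ m≡ ⟨
    m                                                 ∎
    where
    open ≤-Reasoning
    c u v S q : ℕ
    c = x₁ + x₂ + x₃
    u = x₁ + x₃
    v = x₂ + x₃
    S = u + v * a
    q = S / N
    m≡ : m ≡ (x₀ + h * c) * N + d * S
    m≡ = trans (sym eq) (vecA-combination x₀ x₁ x₂ x₃)
    S%N≡t : S % N ≡ t
    S%N≡t = begin-equality
      S % N                                      ≡⟨ τ-cancel S ⟨
      τ ((d * S) % N)                            ≡⟨ cong τ ([m+kn]%n≡m%n (d * S) (x₀ + h * c) N) ⟨
      τ ((d * S + (x₀ + h * c) * N) % N)         ≡⟨ cong (λ x → τ (x % N)) (trans (+-comm (d * S) _) (sym m≡)) ⟩
      τ (m % N)                                  ≡⟨ cong τ m≡wt ⟩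
      τ (w t % N)                                ≡⟨ τ∘w t t<N ⟩
      t                                          ∎
    S≡ : S ≡ t + q * N
    S≡ = trans (m≡m%n+[m/n]*n S N) (cong (_+ q * N) S%N≡t)
    maxDigit≤c : maxDigit t ≤ c
    maxDigit≤c = ≤-trans (maxDigit-minimal {t} {u} {v} {q} t<N S≡) (⊔-lub (+-monoˡ-≤ x₃ (m≤m+n x₁ x₂)) (+-monoˡ-≤ x₃ (m≤n+m x₂ x₁)))
    lemma : ∀ h c n d t x q → h * c * n + d * t + (x * n + d * q * n) ≡ (x + h * c) * n + d * (t + q * n)
    lemma = ℕ-Solver.solve-∀

  open Apéry (Representable (vecA a h d)) N w τ τ<N w∘τ τ∘w rep-w+ w-minimal public

  top : ℕ
  top = a′ * a + a′

  suc-top : suc top ≡ N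
  suc-top = trans (sym (+-suc (a′ * a) a′)) (+-comm (a′ * a) a)

  maxDigit-top : maxDigit top ≡ a′
  maxDigit-top = trans (maxDigit-pair a′ a′ ≤-refl) (⊔-idem a′)

  w≤w-top : ∀ t → t < N → w t ≤ w top
  w≤w-top t t<N = +-mono-≤ (*-monoˡ-≤ N (*-monoʳ-≤ h maxDigit≤)) (*-monoʳ-≤ d (≤-pred (subst (t <_) (sym suc-top) t<N)))
    where
    maxDigit≤ : maxDigit t ≤ maxDigit top
    maxDigit≤ = subst (maxDigit t ≤_) (sym maxDigit-top) (≤-pred (maxDigit<a t<N))

  N≤w-top : 1 ≤ a′ → 1 ≤ h → N ≤ w top
  N≤w-top 1≤a′ 1≤h = begin
    N                         ≡⟨ *-identityˡ N ⟨
    1 * 1 * N                 ≤⟨ *-monoˡ-≤ N (*-mono-≤ 1≤h (≤-trans 1≤a′ (≤-reflexive (sym maxDigit-top)))) ⟩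
    h * maxDigit top * N      ≤⟨ m≤m+n _ (d * top) ⟩
    w top                     ∎
    where open ≤-Reasoning

  frobenius : 1 ≤ a′ → 1 ≤ h → (w top ∸ N ∈ gaps) × All (_≤ w top ∸ N) gaps
  frobenius 1≤a′ 1≤h = gaps-max top (subst (top <_) suc-top ≤-refl) w≤w-top (N≤w-top 1≤a′ 1≤h)

module Formulas (a′ h d : ℕ) (a⊥d : Coprime (suc a′) d) where
  open import Data.Nat using (_^_)
  import Data.Nat.Properties as ℕₚ
  open import Data.Integer using (ℤ; +_; _+_; _-_; _*_; _⊖_)
  open import Data.Integer.Properties using (pos-*; *-cancelˡ-≡; m-n≡m⊖n; ⊖-≥)
  open import Data.Integer.Tactic.RingSolver using (solve-∀; ring)
  open import Tactic.RingSolver.Core.AlmostCommutativeRing using (AlmostCommutativeRing)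
  open AlmostCommutativeRing ring using () renaming (_^_ to _^′_)
  open import Function.Nary.NonDependent using (congₙ)
  open Semigroup a′ h d a⊥d
  open Counting

  A : ℤ
  A = + a

  N≡A*A : + N ≡ A * A
  N≡A*A = pos-* a a

  ∑M ∑M² ∑Mt ∑T ∑T² : ℤ
  ∑M = ∑[ t < N ] (+ maxDigit t)
  ∑M² = ∑[ t < N ] (+ maxDigit t * + maxDigit t)
  ∑Mt = ∑[ t < N ] (+ maxDigit t * + t)
  ∑T = ∑[ t < N ] (+ t)
  ∑T² = ∑[ t < N ] (+ t * + t)

  ∑-over-digits : ∀ (g : ℕ → ℕ → ℤ) → ∑[ t < N ] g (maxDigit t) t ≡ ∑[ j < a ] ∑[ i < a ] g (i ℕ.⊔ j) (j ℕ.* a ℕ.+ i)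
  ∑-over-digits g = trans (∑-pairs a a (λ t → g (maxDigit t) t))
    (∑-cong a (λ j _ → ∑-cong a (λ i i<a → cong (λ m → g m (j ℕ.* a ℕ.+ i)) (maxDigit-pair i j i<a))))

  ∑M-closed : + 6 * ∑M ≡ + 4 * (A * A * A) - + 3 * (A * A) - A
  ∑M-closed = trans (cong (_*_ (+ 6)) (∑-over-digits (λ m _ → + m))) (∑-square-⊔-max a)

  ∑M²-closed : + 6 * ∑M² ≡ + 3 * (A * A * (A - + 1) * (A - + 1)) + A * (A - + 1) * (+ 2 * A - + 1)
  ∑M²-closed = trans (cong (_*_ (+ 6)) (∑-over-digits (λ m _ → + m * + m))) (∑-square-⊔-max² a)

  ∑Mt-closed : + 24 * ∑Mt ≡ (+ 1 + A) * (+ 9 * (A * A * (A - + 1) * (A - + 1)) + + 2 * (A * (A - + 1) * (+ 2 * A - + 1)))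
  ∑Mt-closed = begin
    + 24 * ∑Mt
      ≡⟨ cong (_*_ (+ 24)) (∑-over-digits (λ m t → + m * + t)) ⟩
    + 24 * ∑[ j < a ] ∑[ i < a ] (+ (i ℕ.⊔ j) * + (j ℕ.* a ℕ.+ i))
      ≡⟨ cong (_*_ (+ 24)) (∑-cong a (λ j _ → ∑-cong a (λ i _ → cong (_*_ (+ (i ℕ.⊔ j))) (digits-ℤ i j)))) ⟩
    + 24 * ∑[ j < a ] ∑[ i < a ] (+ (i ℕ.⊔ j) * (+ i + + j * A))
      ≡⟨ ∑-square-⊔-max-weighted a A ⟩
    (+ 1 + A) * (+ 9 * (A * A * (A - + 1) * (A - + 1)) + + 2 * (A * (A - + 1) * (+ 2 * A - + 1)))
      ∎
    where
    open ≡-Reasoning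
    digits-ℤ : ∀ i j → + (j ℕ.* a ℕ.+ i) ≡ + i + + j * A
    digits-ℤ i j = trans (cong +_ (ℕₚ.+-comm (j ℕ.* a) i)) (cong (_+_ (+ i)) (pos-* j a))

  ∑T-closed : + 2 * ∑T ≡ A * A * (A * A - + 1)
  ∑T-closed = trans (∑-id N) (cong (λ n → n * (n - + 1)) N≡A*A)

  ∑T²-closed : + 6 * ∑T² ≡ A * A * (A * A - + 1) * (+ 2 * (A * A) - + 1)
  ∑T²-closed = trans (∑-square N) (cong (λ n → n * (n - + 1) * (+ 2 * n - + 1)) N≡A*A)

  w-ℤ : ∀ t → + w t ≡ + h * + maxDigit t * (A * A) + + d * + t
  w-ℤ t = cong₂ _+_ (trans (pos-* (h ℕ.* maxDigit t) N) (cong₂ _*_ (pos-* h (maxDigit t)) N≡A*A)) (pos-* d t)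

  ∑-w : ∑[ t < N ] (+ w t) ≡ + h * (A * A) * ∑M + + d * ∑T
  ∑-w = begin
    ∑[ t < N ] (+ w t)
      ≡⟨ ∑-cong N (λ t _ → trans (w-ℤ t) (rearrange (+ h) (A * A) (+ maxDigit t) (+ d) (+ t))) ⟩
    ∑[ t < N ] (+ h * (A * A) * + maxDigit t + + d * + t)
      ≡⟨ ∑-distrib-+ N (λ t → + h * (A * A) * + maxDigit t) (λ t → + d * + t) ⟩
    ∑[ t < N ] (+ h * (A * A) * + maxDigit t) + ∑[ t < N ] (+ d * + t)
      ≡⟨ cong₂ _+_ (∑-*ˡ N (+ h * (A * A)) (λ t → + maxDigit t)) (∑-*ˡ N (+ d) (λ t → + t)) ⟩
    + h * (A * A) * ∑M + + d * ∑T
      ∎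
    where
    open ≡-Reasoning
    rearrange : ∀ h n m d t → h * m * n + d * t ≡ h * n * m + d * t
    rearrange = solve-∀

  ∑-w² : ∑[ t < N ] (+ w t * + w t) ≡ (+ h * (A * A)) * (+ h * (A * A)) * ∑M² + + 2 * + h * + d * (A * A) * ∑Mt + + d * + d * ∑T²
  ∑-w² = begin
    ∑[ t < N ] (+ w t * + w t)
      ≡⟨ ∑-cong N (λ t _ → trans (cong (λ x → x * x) (w-ℤ t)) (expand (+ h) (A * A) (+ maxDigit t) (+ d) (+ t))) ⟩
    ∑[ t < N ] (c₁ * M² t + c₂ * Mt t + c₃ * t² t)
      ≡⟨ ∑-distrib-+ N (λ t → c₁ * M² t + c₂ * Mt t) (λ t → c₃ * t² t) ⟩
    ∑[ t < N ] (c₁ * M² t + c₂ * Mt t) + ∑[ t < N ] (c₃ * t² t)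
      ≡⟨ cong (_+ ∑[ t < N ] (c₃ * t² t)) (∑-distrib-+ N (λ t → c₁ * M² t) (λ t → c₂ * Mt t)) ⟩
    ∑[ t < N ] (c₁ * M² t) + ∑[ t < N ] (c₂ * Mt t) + ∑[ t < N ] (c₃ * t² t)
      ≡⟨ cong₂ _+_ (cong₂ _+_ (∑-*ˡ N c₁ M²) (∑-*ˡ N c₂ Mt)) (∑-*ˡ N c₃ t²) ⟩
    c₁ * ∑M² + c₂ * ∑Mt + c₃ * ∑T²
      ∎
    where
    open ≡-Reasoning
    c₁ c₂ c₃ : ℤ
    c₁ = (+ h * (A * A)) * (+ h * (A * A))
    c₂ = + 2 * + h * + d * (A * A)
    c₃ = + d * + d
    M² Mt t² : ℕ → ℤ
    M² t = + maxDigit t * + maxDigit t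
    Mt t = + maxDigit t * + t
    t² t = + t * + t
    expand : ∀ h n m d t → (h * m * n + d * t) * (h * m * n + d * t)
                         ≡ (h * n) * (h * n) * (m * m) + + 2 * h * d * n * (m * t) + d * d * (t * t)
    expand = solve-∀

  length-via-power-sums : + N * (+ 6 * + length gaps) ≡ + h * (A * A) * (+ 6 * ∑M) + + 3 * (+ d - + 1) * (+ 2 * ∑T)
  length-via-power-sums = begin
    + N * (+ 6 * + length gaps)                  ≡⟨ swap (+ N) (+ length gaps) ⟩
    + 6 * (+ N * + length gaps)                  ≡⟨ cong (_*_ (+ 6)) selmer-length ⟩
    + 6 * (∑[ t < N ] (+ w t) - ∑T)              ≡⟨ cong (λ s → + 6 * (s - ∑T)) ∑-w ⟩
    + 6 * (+ h * (A * A) * ∑M + + d * ∑T - ∑T)   ≡⟨ regroup A (+ h) (+ d) ∑M ∑T ⟩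
    + h * (A * A) * (+ 6 * ∑M) + + 3 * (+ d - + 1) * (+ 2 * ∑T) ∎
    where
    open ≡-Reasoning
    swap : ∀ n l → n * (+ 6 * l) ≡ + 6 * (n * l)
    swap = solve-∀
    regroup : ∀ a h d m t → + 6 * (h * (a * a) * m + d * t - t) ≡ h * (a * a) * (+ 6 * m) + + 3 * (d - + 1) * (+ 2 * t)
    regroup = solve-∀

  sumCombination : ℤ → ℤ → ℤ → ℤ → ℤ → ℤ
  sumCombination m² mt t² m t = + 2 * (+ h * (A * A)) * (+ h * (A * A)) * m² + + h * + d * (A * A) * mt + + 2 * (+ d * + d - + 1) * t²
                                - + 2 * + h * (A * A) * (A * A) * m - + 6 * (A * A) * (+ d - + 1) * t

  sum-via-power-sums : + N * (+ 24 * + sum gaps) ≡ sumCombination (+ 6 * ∑M²) (+ 24 * ∑Mt) (+ 6 * ∑T²) (+ 6 * ∑M) (+ 2 * ∑T)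
  sum-via-power-sums = begin
    + N * (+ 24 * + sum gaps)
      ≡⟨ swap (+ N) (+ sum gaps) ⟩
    + 12 * (+ 2 * + N * + sum gaps)
      ≡⟨ cong (_*_ (+ 12)) selmer-sum ⟩
    + 12 * (∑[ t < N ] (+ w t * + w t) - ∑T² - + N * (∑[ t < N ] (+ w t) - ∑T))
      ≡⟨ congₙ 3 (λ x n y → + 12 * (x - ∑T² - n * (y - ∑T))) ∑-w² N≡A*A ∑-w ⟩
    + 12 * ((+ h * (A * A)) * (+ h * (A * A)) * ∑M² + + 2 * + h * + d * (A * A) * ∑Mt + + d * + d * ∑T² - ∑T²
            - A * A * (+ h * (A * A) * ∑M + + d * ∑T - ∑T))
      ≡⟨ regroup A (+ h) (+ d) ∑M² ∑Mt ∑T² ∑M ∑T ⟩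
    sumCombination (+ 6 * ∑M²) (+ 24 * ∑Mt) (+ 6 * ∑T²) (+ 6 * ∑M) (+ 2 * ∑T)
      ∎
    where
    open ≡-Reasoning
    swap : ∀ n s → n * (+ 24 * s) ≡ + 12 * (+ 2 * n * s)
    swap = solve-∀
    regroup : ∀ a h d m² mt t² m t →
      + 12 * ((h * (a * a)) * (h * (a * a)) * m² + + 2 * h * d * (a * a) * mt + d * d * t² - t² - a * a * (h * (a * a) * m + d * t - t))
      ≡ + 2 * (h * (a * a)) * (h * (a * a)) * (+ 6 * m²) + h * d * (a * a) * (+ 24 * mt) + + 2 * (d * d - + 1) * (+ 6 * t²)
        - + 2 * h * (a * a) * (a * a) * (+ 6 * m) - + 6 * (a * a) * (d - + 1) * (+ 2 * t)
    regroup = solve-∀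

  frobenius-formula : 1 ℕ.≤ a′ → 1 ℕ.≤ h → + (w top ℕ.∸ N) ≡ + h * + a ^ 3 + (+ d - + h - + 1) * + a ^ 2 - + d
  frobenius-formula 1≤a′ 1≤h = begin
    + (w top ℕ.∸ N)                                          ≡⟨ ⊖-≥ (N≤w-top 1≤a′ 1≤h) ⟨
    w top ⊖ N                                                ≡⟨ m-n≡m⊖n (w top) N ⟨
    + w top - + N                                            ≡⟨ cong₂ _-_ (w-ℤ top) N≡A*A ⟩
    + h * + maxDigit top * (A * A) + + d * + top - A * A     ≡⟨ cong₂ (λ m t → + h * + m * (A * A) + + d * t - A * A) maxDigit-top (cong (_+ + a′) (pos-* a′ a)) ⟩
    + h * + a′ * (A * A) + + d * (+ a′ * A + + a′) - A * A   ≡⟨ polynomial (+ a′) (+ h) (+ d) ⟩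
    + h * A ^′ 3 + (+ d - + h - + 1) * A ^′ 2 - + d          ≡⟨ cong₂ (λ p₃ p₂ → + h * p₃ + (+ d - + h - + 1) * p₂ - + d) (pos-^ a 3) (pos-^ a 2) ⟨
    + h * + a ^ 3 + (+ d - + h - + 1) * + a ^ 2 - + d        ∎
    where
    open ≡-Reasoning
    polynomial : ∀ m h d → h * m * ((+ 1 + m) * (+ 1 + m)) + d * (m * (+ 1 + m) + m) - (+ 1 + m) * (+ 1 + m)
                         ≡ h * (+ 1 + m) ^′ 3 + (d - h - + 1) * (+ 1 + m) ^′ 2 - d
    polynomial = solve-∀

  lengthPolynomial : ℤ → ℤ → ℤ
  lengthPolynomial a³ a² = + 4 * + h * a³ + + 3 * (+ d - + h - + 1) * a² - + h * A + + 3 * (+ 1 - + d)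

  length-scaled : + N * (+ 6 * + length gaps) ≡ + N * lengthPolynomial (A ^′ 3) (A ^′ 2)
  length-scaled = begin
    + N * (+ 6 * + length gaps)                                   ≡⟨ length-via-power-sums ⟩
    + h * (A * A) * (+ 6 * ∑M) + + 3 * (+ d - + 1) * (+ 2 * ∑T)   ≡⟨ cong₂ (λ x y → + h * (A * A) * x + + 3 * (+ d - + 1) * y) ∑M-closed ∑T-closed ⟩
    + h * (A * A) * (+ 4 * (A * A * A) - + 3 * (A * A) - A) + + 3 * (+ d - + 1) * (A * A * (A * A - + 1))
                                                                  ≡⟨ polynomial A (+ h) (+ d) ⟩
    A * A * lengthPolynomial (A ^′ 3) (A ^′ 2)                    ≡⟨ cong (_* lengthPolynomial (A ^′ 3) (A ^′ 2)) N≡A*A ⟨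
    + N * lengthPolynomial (A ^′ 3) (A ^′ 2)                      ∎
    where
    open ≡-Reasoning
    polynomial : ∀ a h d → h * (a * a) * (+ 4 * (a * a * a) - + 3 * (a * a) - a) + + 3 * (d - + 1) * (a * a * (a * a - + 1))
                         ≡ a * a * (+ 4 * h * a ^′ 3 + + 3 * (d - h - + 1) * a ^′ 2 - h * a + + 3 * (+ 1 - d))
    polynomial = solve-∀

  length-formula : + 6 * + length gaps ≡ + 4 * + h * + a ^ 3 + + 3 * (+ d - + h - + 1) * + a ^ 2 - + h * + a + + 3 * (+ 1 - + d)
  length-formula = trans (*-cancelˡ-≡ (+ N) _ _ length-scaled) (sym (cong₂ lengthPolynomial (pos-^ a 3) (pos-^ a 2)))

  sumPolynomial : ℤ → ℤ → ℤ → ℤ → ℤ → ℤ → ℤ → ℤ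
  sumPolynomial h² d² a² a³ a⁴ a⁵ a⁶ = + 6 * h² * a⁶
                                       + (+ 9 * + d * + h - + 8 * h² - + 8 * + h) * a⁵
                                       + (+ 4 * d² - + 5 * + d * + h - + 6 * + d + + 6 * + h + + 2) * a⁴
                                       + (+ 2 * h² - + 11 * + d * + h + + 2 * + h) * a³
                                       + (+ 5 * + d * + h - + 6 * d² + + 6 * + d) * a²
                                       + + 2 * + d * + h * A + + 2 * d² - + 2

  sum-scaled : + N * (+ 24 * + sum gaps) ≡ + N * sumPolynomial ((+ h) ^′ 2) ((+ d) ^′ 2) (A ^′ 2) (A ^′ 3) (A ^′ 4) (A ^′ 5) (A ^′ 6)
  sum-scaled = begin
    + N * (+ 24 * + sum gaps)
      ≡⟨ sum-via-power-sums ⟩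
    sumCombination (+ 6 * ∑M²) (+ 24 * ∑Mt) (+ 6 * ∑T²) (+ 6 * ∑M) (+ 2 * ∑T)
      ≡⟨ congₙ 5 sumCombination ∑M²-closed ∑Mt-closed ∑T²-closed ∑M-closed ∑T-closed ⟩
    sumCombination (+ 3 * (A * A * (A - + 1) * (A - + 1)) + A * (A - + 1) * (+ 2 * A - + 1))
                   ((+ 1 + A) * (+ 9 * (A * A * (A - + 1) * (A - + 1)) + + 2 * (A * (A - + 1) * (+ 2 * A - + 1))))
                   (A * A * (A * A - + 1) * (+ 2 * (A * A) - + 1))
                   (+ 4 * (A * A * A) - + 3 * (A * A) - A)
                   (A * A * (A * A - + 1))
      ≡⟨ polynomial A (+ h) (+ d) ⟩
    A * A * RHS
      ≡⟨ cong (_* RHS) N≡A*A ⟨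
    + N * RHS
      ∎
    where
    open ≡-Reasoning
    RHS : ℤ
    RHS = sumPolynomial ((+ h) ^′ 2) ((+ d) ^′ 2) (A ^′ 2) (A ^′ 3) (A ^′ 4) (A ^′ 5) (A ^′ 6)
    polynomial : ∀ a h d →
      + 2 * (h * (a * a)) * (h * (a * a)) * (+ 3 * (a * a * (a - + 1) * (a - + 1)) + a * (a - + 1) * (+ 2 * a - + 1))
      + h * d * (a * a) * ((+ 1 + a) * (+ 9 * (a * a * (a - + 1) * (a - + 1)) + + 2 * (a * (a - + 1) * (+ 2 * a - + 1))))
      + + 2 * (d * d - + 1) * (a * a * (a * a - + 1) * (+ 2 * (a * a) - + 1))
      - + 2 * h * (a * a) * (a * a) * (+ 4 * (a * a * a) - + 3 * (a * a) - a)
      - + 6 * (a * a) * (d - + 1) * (a * a * (a * a - + 1))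
      ≡ a * a * (+ 6 * h ^′ 2 * a ^′ 6 + (+ 9 * d * h - + 8 * h ^′ 2 - + 8 * h) * a ^′ 5
                 + (+ 4 * d ^′ 2 - + 5 * d * h - + 6 * d + + 6 * h + + 2) * a ^′ 4
                 + (+ 2 * h ^′ 2 - + 11 * d * h + + 2 * h) * a ^′ 3
                 + (+ 5 * d * h - + 6 * d ^′ 2 + + 6 * d) * a ^′ 2
                 + + 2 * d * h * a + + 2 * d ^′ 2 - + 2)
    polynomial = solve-∀

  sum-formula : + 24 * + sum gaps ≡ + 6 * + h ^ 2 * + a ^ 6
                                    + (+ 9 * + d * + h - + 8 * + h ^ 2 - + 8 * + h) * + a ^ 5
                                    + (+ 4 * + d ^ 2 - + 5 * + d * + h - + 6 * + d + + 6 * + h + + 2) * + a ^ 4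
                                    + (+ 2 * + h ^ 2 - + 11 * + d * + h + + 2 * + h) * + a ^ 3
                                    + (+ 5 * + d * + h - + 6 * + d ^ 2 + + 6 * + d) * + a ^ 2
                                    + + 2 * + d * + h * + a + + 2 * + d ^ 2 - + 2
  sum-formula = trans (*-cancelˡ-≡ (+ N) _ _ sum-scaled)
    (sym (congₙ 7 sumPolynomial (pos-^ h 2) (pos-^ d 2) (pos-^ a 2) (pos-^ a 3) (pos-^ a 4) (pos-^ a 5) (pos-^ a 6)))

open import Data.Nat using (_<_; _≤_; _^_; s≤s)
open import Data.Nat.GCD using (gcd)
open import Data.Integer using (ℤ; +_; _+_; _-_; _*_)

theorem3p10 : (a h d : ℕ) → 1 < a → 1 ≤ h → 1 ≤ d → gcd a d ≡ 1 →
  Σ (List ℕ) λ L → Σ ℕ λ g →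
    IsNRList (vecA a h d) L
    × IsMaxOf L g
    × (+ g ≡ + h * + a ^ 3 + (+ d - + h - + 1) * + a ^ 2 - + d)
    × (+ 6 * + length L ≡ + 4 * + h * + a ^ 3 + + 3 * (+ d - + h - + 1) * + a ^ 2 - + h * + a + + 3 * (+ 1 - + d))
    × (+ 24 * + sum L ≡ + 6 * + h ^ 2 * + a ^ 6
                        + (+ 9 * + d * + h - + 8 * + h ^ 2 - + 8 * + h) * + a ^ 5
                        + (+ 4 * + d ^ 2 - + 5 * + d * + h - + 6 * + d + + 6 * + h + + 2) * + a ^ 4
                        + (+ 2 * + h ^ 2 - + 11 * + d * + h + + 2 * + h) * + a ^ 3
                        + (+ 5 * + d * + h - + 6 * + d ^ 2 + + 6 * + d) * + a ^ 2
                        + + 2 * + d * + h * + a + + 2 * + d ^ 2 - + 2)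
theorem3p10 (suc a′) h d (s≤s 1≤a′) 1≤h _ gcd≡1 =
  gaps , w top ℕ.∸ N , (gaps-unique , ∈-gaps⇔¬rep) , frobenius 1≤a′ 1≤h ,
  frobenius-formula 1≤a′ 1≤h , length-formula , sum-formula
  where
  a⊥d : Coprime (suc a′) d
  a⊥d = Coprimality.gcd≡1⇒coprime gcd≡1
  open Semigroup a′ h d a⊥d
  open Formulas a′ h d a⊥d
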